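{- If $G$ is a connected graph without isolated vertices with $sp(G)=\Delta(G)$, then either $G$ is an odd cycle or $G$ is a tree.
   Context: Graphs are finite, undirected, without loops, but may have multiple edges. $\Delta(G)$ is the maximum degree of $G$. For a graph $G$ without isolated vertices, $sp(G)$ is the least integer $k$ such that $G$ has a subgraph $H$ with $V(H)=V(G)$ and $1\le d_H(v)\le k$ for all vertices $v$ (equivalently, the least $k$ such that $G$ has a $k$-edge-colorable subgraph in which every vertex of $G$ has degree at least $1$). -}

module Defs where

open import Data.Nat using (ℕ; zero; suc; _+_; _*_; _≤_; _<_; _⊔_; _<?_)
open import Data.Fin using (Fin; toℕ; fromℕ<; _≟_)
import Data.Fin as F
open import Data.Bool using (Bool; true; false; _∧_; _∨_; if_then_else_)
open import Data.Product using (Σ; _×_; _,_; proj₁; proj₂; ∃)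
open import Data.Sum using (_⊎_)
open import Function.Definitions using (Injective)
open import Relation.Binary.PropositionalEquality using (_≡_; _≢_)
open import Relation.Nullary using (¬_; yes; no)
open import Relation.Nullary.Decidable using (⌊_⌋)

-- A finite multigraph without loops: vertices Fin n, edges Fin m,
-- each edge has an (unordered) pair of distinct endpoints.
-- Parallel edges are allowed (different edge indices with same ends).
record Graph : Set where
  field
    n      : ℕ
    m      : ℕ
    ends   : Fin m → Fin n × Fin n
    noLoop : ∀ e → proj₁ (ends e) ≢ proj₂ (ends e)
open Graph public

count : ∀ {k} → (Fin k → Bool) → ℕ
count {zero}  p = 0
count {suc k} p = (if p F.zero then 1 else 0) + count (λ i → p (F.suc i))

maxF : ∀ {k} → (Fin k → ℕ) → ℕ
maxF {zero}  f = 0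
maxF {suc k} f = f F.zero ⊔ maxF (λ i → f (F.suc i))

incident : (G : Graph) → Fin (m G) → Fin (n G) → Bool
incident G e v = ⌊ v ≟ proj₁ (ends G e) ⌋ ∨ ⌊ v ≟ proj₂ (ends G e) ⌋

-- a spanning subgraph H of G (V(H) = V(G)) is given by a selection of edges
SpanningSub : Graph → Set
SpanningSub G = Fin (m G) → Bool

degIn : (G : Graph) → SpanningSub G → Fin (n G) → ℕ
degIn G s v = count (λ e → s e ∧ incident G e v)

deg : (G : Graph) → Fin (n G) → ℕ
deg G v = count (λ e → incident G e v)

Δ : Graph → ℕ
Δ G = maxF (deg G)

NoIsolated : Graph → Set
NoIsolated G = ∀ v → 1 ≤ deg G v

HasSpan : Graph → ℕ → Set
HasSpan G k = Σ (SpanningSub G) λ s → ∀ v → 1 ≤ degIn G s v × degIn G s v ≤ k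

-- sp(G) = k  :  k is the least integer with HasSpan G k
SpEq : Graph → ℕ → Set
SpEq G k = HasSpan G k × (∀ j → HasSpan G j → k ≤ j)

Joins : (G : Graph) → Fin (m G) → Fin (n G) → Fin (n G) → Set
Joins G e a b = (ends G e ≡ (a , b)) ⊎ (ends G e ≡ (b , a))

data Reach (G : Graph) : Fin (n G) → Fin (n G) → Set where
  here : ∀ {v} → Reach G v v
  step : ∀ {u w v} (e : Fin (m G)) → Joins G e u w → Reach G w v → Reach G u v

Connected : Graph → Set
Connected G = 1 ≤ n G × (∀ u v → Reach G u v)

next : ∀ {k} → Fin k → Fin k
next {zero} ()
next {suc k} i with suc (toℕ i) <? suc k
... | yes p = fromℕ< p
... | no _  = F.zero

-- a cycle in G of length k ≥ 2: distinct vertices vs 0..k-1, distinct edges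
-- es 0..k-1, es i joining vs i and vs (i+1 mod k)
-- (k = 2 means two distinct parallel edges)
record Cycle (G : Graph) (k : ℕ) : Set where
  field
    len≥2  : 2 ≤ k
    vs     : Fin k → Fin (n G)
    es     : Fin k → Fin (m G)
    vs-inj : Injective _≡_ _≡_ vs
    es-inj : Injective _≡_ _≡_ es
    joins  : ∀ i → Joins G (es i) (vs i) (vs (next i))

HasCycle : Graph → Set
HasCycle G = ∃ λ k → Cycle G k

IsTree : Graph → Set
IsTree G = Connected G × ¬ HasCycle G

Odd : ℕ → Set
Odd k = ∃ λ j → k ≡ 1 + 2 * j

IsOddCycle : Graph → Set
IsOddCycle G = Odd (n G) × m G ≡ n G × Cycle G (n G)

module Submission where

-- Suppose G contains a cycle C.
--   (1) If Δ ≥ 3 then sp(G) ≤ Δ - 1.  Grow a breadth-first forest from C: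
--       every vertex off C gets a parent edge towards C, every vertex vs i of
--       C owns the cycle edge es i.  Call v selected when none of its children
--       is selected (a recursion from the farthest layer towards C) and
--       keep exactly the owned edges of selected vertices.  A selected vertex
--       keeps its own edge and at most one more (the preceding cycle edge), an
--       unselected one loses its own edge but keeps that of a selected child.
--   (2) Hence Δ ≤ 2.  Then C is Hamiltonian and uses every edge of G, and if
--       its length were even, alternate edges of C would show sp(G) = 1 < 2.
-- So a graph with a cycle is an odd cycle; otherwise G is a tree.

open import Defs
open import Data.Nat using (ℕ; zero; suc; _+_; _*_; _≤_; _<_; _∸_; z≤n; s≤s; s≤s⁻¹; _≤?_; _<?_)
open import Data.Nat.Properties hiding (_≟_)
open import Data.Fin using (Fin; toℕ; _≟_; fromℕ; inject₁)
import Data.Fin as F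
import Data.Fin.Properties as FinP
open import Data.Vec.Functional using (_∷_)
open import Data.Bool using (Bool; true; false; _∧_; _∨_; not)
open import Data.Bool.Properties using (∨-zeroʳ)
open import Data.Product using (Σ; _×_; _,_; proj₁; proj₂; ∃)
import Data.Product.Properties as ProdP
open import Data.Sum using (_⊎_; inj₁; inj₂)
open import Data.Empty using (⊥; ⊥-elim)
open import Function using (_∘_)
open import Function.Definitions using (Injective)
open import Relation.Binary.PropositionalEquality
open import Relation.Nullary using (¬_; yes; no; Dec; does; contradiction)
open import Relation.Nullary.Decidable using (dec-true; _×-dec_; _⊎-dec_; _→-dec_; map′)

∧-true : ∀ {a b} → a ∧ b ≡ true → a ≡ true × b ≡ true
∧-true {true} {true} _ = refl , refl

∧-intro : ∀ {a b} → a ≡ true → b ≡ true → a ∧ b ≡ true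
∧-intro refl refl = refl

∨-true : ∀ {a b} → a ∨ b ≡ true → a ≡ true ⊎ b ≡ true
∨-true {true}  _ = inj₁ refl
∨-true {false} h = inj₂ h

not-false : ∀ {b} → not b ≡ false → b ≡ true
not-false {true} _ = refl

not-true : ∀ {b} → not b ≡ true → b ≡ false
not-true {false} _ = refl

∨-left : ∀ {x y} → x ≡ true → x ∨ y ≡ true
∨-left refl = refl

∨-right : ∀ {x y} → y ≡ true → x ∨ y ≡ true
∨-right {x} refl = ∨-zeroʳ x

true≢false : true ≢ false
true≢false ()

does-witness : ∀ {P : Set} (P? : Dec P) → does P? ≡ true → P
does-witness (yes p) _ = p

count-mono : ∀ {k} (p q : Fin k → Bool) → (∀ i → p i ≡ true → q i ≡ true) →
             count p ≤ count q
count-mono {zero}  p q p⇒q = z≤n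
count-mono {suc k} p q p⇒q with p F.zero in p0 | q F.zero in q0
... | true  | true  = s≤s (count-mono _ _ (λ i → p⇒q (F.suc i)))
... | true  | false = contradiction (trans (sym (p⇒q F.zero p0)) q0) true≢false
... | false | true  = m≤n⇒m≤1+n (count-mono _ _ (λ i → p⇒q (F.suc i)))
... | false | false = count-mono _ _ (λ i → p⇒q (F.suc i))

count-strict : ∀ {k} (p q : Fin k → Bool) → (∀ i → p i ≡ true → q i ≡ true) →
               (j : Fin k) → p j ≡ false → q j ≡ true → count p < count q
count-strict {suc k} p q p⇒q F.zero pj qj rewrite pj | qj =
  s≤s (count-mono _ _ (λ i → p⇒q (F.suc i)))
count-strict {suc k} p q p⇒q (F.suc j) pj qj with p F.zero in p0 | q F.zero in q0
... | true  | true  = s≤s (count-strict _ _ (λ i → p⇒q (F.suc i)) j pj qj)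
... | true  | false = contradiction (trans (sym (p⇒q F.zero p0)) q0) true≢false
... | false | true  = m≤n⇒m≤1+n (count-strict _ _ (λ i → p⇒q (F.suc i)) j pj qj)
... | false | false = count-strict _ _ (λ i → p⇒q (F.suc i)) j pj qj

count-zero : ∀ {k} (p : Fin k → Bool) → (∀ i → p i ≡ false) → count p ≡ 0
count-zero {zero}  p none = refl
count-zero {suc k} p none rewrite none F.zero = count-zero _ (λ i → none (F.suc i))

count-pos : ∀ {k} (p : Fin k → Bool) (j : Fin k) → p j ≡ true → 1 ≤ count p
count-pos {k} p j pj = subst (λ c → suc c ≤ count p) (count-zero {k} (λ _ → false) (λ _ → refl))
  (count-strict (λ _ → false) p (λ _ ()) j refl pj)

count-≤1 : ∀ {k} (p : Fin k → Bool) → (∀ i j → p i ≡ true → p j ≡ true → i ≡ j) →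
           count p ≤ 1
count-≤1 {zero}  p unique = z≤n
count-≤1 {suc k} p unique with p F.zero in p0
... | true  = s≤s (≤-reflexive (count-zero _ no-other))
  where
  no-other : ∀ i → p (F.suc i) ≡ false
  no-other i with p (F.suc i) in pi
  ... | true  = contradiction (unique F.zero (F.suc i) p0 pi) (λ ())
  ... | false = refl
... | false = count-≤1 _ (λ i j pi pj → FinP.suc-injective (unique (F.suc i) (F.suc j) pi pj))

count-∨ : ∀ {k} (p q : Fin k → Bool) → count (λ i → p i ∨ q i) ≤ count p + count q
count-∨ {zero}  p q = z≤n
count-∨ {suc k} p q with p F.zero | q F.zero
... | true  | true  = s≤s (≤-trans (m≤n⇒m≤1+n (count-∨ (λ i → p (F.suc i)) (λ i → q (F.suc i))))
                                  (≤-reflexive (sym (+-suc _ _))))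
... | true  | false = s≤s (count-∨ (λ i → p (F.suc i)) (λ i → q (F.suc i)))
... | false | true  = ≤-trans (s≤s (count-∨ (λ i → p (F.suc i)) (λ i → q (F.suc i))))
                              (≤-reflexive (sym (+-suc _ _)))
... | false | false = count-∨ (λ i → p (F.suc i)) (λ i → q (F.suc i))

eqF : ∀ {k} → Fin k → Fin k → Bool
eqF F.zero    F.zero    = true
eqF F.zero    (F.suc b) = false
eqF (F.suc a) F.zero    = false
eqF (F.suc a) (F.suc b) = eqF a b

eqF-sound : ∀ {k} (a b : Fin k) → eqF a b ≡ true → a ≡ b
eqF-sound F.zero    F.zero    _ = refl
eqF-sound (F.suc a) (F.suc b) h = cong F.suc (eqF-sound a b h)

eqF-refl : ∀ {k} (a : Fin k) → eqF a a ≡ true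
eqF-refl F.zero    = refl
eqF-refl (F.suc a) = eqF-refl a

eqF-false : ∀ {k} (a b : Fin k) → a ≢ b → eqF a b ≡ false
eqF-false a b a≢b with eqF a b in eq
... | false = refl
... | true  = contradiction (eqF-sound a b eq) a≢b

count-≤2 : ∀ {k} (p : Fin k → Bool) (a : Fin k) →
           (∀ i j → p i ≡ true → p j ≡ true → i ≢ a → j ≢ a → i ≡ j) → count p ≤ 2
count-≤2 {k} p a unique = begin
  count p                                    ≤⟨ count-mono p (λ i → eqF a i ∨ other i) split ⟩
  count (λ i → eqF a i ∨ other i)            ≤⟨ count-∨ (eqF a) other ⟩
  count (eqF a) + count other                ≤⟨ +-mono-≤ (count-≤1 (eqF a) single)
                                                          (count-≤1 other unique′) ⟩
  2                                          ∎
  where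
  open ≤-Reasoning
  other : Fin k → Bool
  other i = p i ∧ not (eqF a i)
  split : ∀ i → p i ≡ true → (eqF a i ∨ other i) ≡ true
  split i pi with eqF a i
  ... | true  = refl
  ... | false rewrite pi = refl
  single : ∀ i j → eqF a i ≡ true → eqF a j ≡ true → i ≡ j
  single i j ai aj = trans (sym (eqF-sound a i ai)) (eqF-sound a j aj)
  ≢a : ∀ i → not (eqF a i) ≡ true → i ≢ a
  ≢a i h refl = contradiction (eqF-refl i) (λ t → true≢false (trans (sym t) (not-true h)))
  unique′ : ∀ i j → other i ≡ true → other j ≡ true → i ≡ j
  unique′ i j oi oj with ∧-true {p i} oi | ∧-true {p j} oj
  ... | pi , ni | pj , nj = unique i j pi pj (≢a i ni) (≢a j nj)

count-≥2 : ∀ {k} (p : Fin k → Bool) (a b : Fin k) → a ≢ b → p a ≡ true → p b ≡ true →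
           2 ≤ count p
count-≥2 p a b a≢b pa pb =
  ≤-trans (s≤s (count-pos (eqF a) a (eqF-refl a)))
          (count-strict (eqF a) p (λ i ai → subst (λ x → p x ≡ true) (eqF-sound a i ai) pa)
                        b (eqF-false a b a≢b) pb)

count-≥3 : ∀ {k} (p : Fin k → Bool) (a b c : Fin k) → a ≢ b → a ≢ c → b ≢ c →
           p a ≡ true → p b ≡ true → p c ≡ true → 3 ≤ count p
count-≥3 {k} p a b c a≢b a≢c b≢c pa pb pc = begin
  3                  ≤⟨ s≤s (s≤s (count-pos (eqF a) a (eqF-refl a))) ⟩
  2 + count one      ≤⟨ s≤s (count-strict one two (λ _ → ∨-left) b (eqF-false a b a≢b)
                                            (∨-right (eqF-refl b))) ⟩
  suc (count two)    ≤⟨ count-strict two three (λ _ → ∨-left) c two-c (∨-right (eqF-refl c)) ⟩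
  count three        ≤⟨ count-mono three p in-p ⟩
  count p            ∎
  where
  open ≤-Reasoning
  one two three : Fin k → Bool
  one i = eqF a i
  two i = one i ∨ eqF b i
  three i = two i ∨ eqF c i
  two-c : two c ≡ false
  two-c rewrite eqF-false a c a≢c | eqF-false b c b≢c = refl
  in-p : ∀ i → three i ≡ true → p i ≡ true
  in-p i h with ∨-true {two i} h
  ... | inj₂ ci = subst (λ x → p x ≡ true) (eqF-sound c i ci) pc
  ... | inj₁ ti with ∨-true {one i} ti
  ... | inj₁ ai = subst (λ x → p x ≡ true) (eqF-sound a i ai) pa
  ... | inj₂ bi = subst (λ x → p x ≡ true) (eqF-sound b i bi) pb

anyB : ∀ {k} → (Fin k → Bool) → Bool
anyB {zero}  p = false
anyB {suc k} p = p F.zero ∨ anyB (λ i → p (F.suc i))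

anyB-intro : ∀ {k} (p : Fin k → Bool) (j : Fin k) → p j ≡ true → anyB p ≡ true
anyB-intro p F.zero    pj rewrite pj = refl
anyB-intro p (F.suc j) pj with p F.zero
... | true  = refl
... | false = anyB-intro _ j pj

anyB-elim : ∀ {k} (p : Fin k → Bool) → anyB p ≡ true → ∃ λ j → p j ≡ true
anyB-elim {suc k} p h with p F.zero in p0
... | true  = F.zero , p0
... | false with anyB-elim _ h
...   | j , pj = F.suc j , pj

anyB-cong : ∀ {k} (p q : Fin k → Bool) → (∀ i → p i ≡ q i) → anyB p ≡ anyB q
anyB-cong {zero}  p q p≗q = refl
anyB-cong {suc k} p q p≗q rewrite p≗q F.zero =
  cong (q F.zero ∨_) (anyB-cong _ _ (λ i → p≗q (F.suc i)))

maxF-≤ : ∀ {k} (f : Fin k → ℕ) (i : Fin k) → f i ≤ maxF f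
maxF-≤ f F.zero    = m≤m⊔n _ _
maxF-≤ f (F.suc i) = ≤-trans (maxF-≤ (λ j → f (F.suc j)) i) (m≤n⊔m _ _)

least : (f : ℕ → Bool) (b : ℕ) → f b ≡ true →
        Σ ℕ λ r → f r ≡ true × (∀ t → f t ≡ true → r ≤ t)
least f b fb with f 0 in f0
... | true = 0 , f0 , λ _ _ → z≤n
least f zero    fb | false = contradiction (trans (sym fb) f0) true≢false
least f (suc b) fb | false with least (λ t → f (suc t)) b fb
... | r , fr , r-min = suc r , fr , below
  where
  below : ∀ t → f t ≡ true → suc r ≤ t
  below zero    ft = contradiction (trans (sym ft) f0) true≢false
  below (suc t) ft = s≤s (r-min t ft)

next-cases : ∀ {k} (i : Fin (suc k)) →
             toℕ (next i) ≡ suc (toℕ i) ⊎ (toℕ i ≡ k × toℕ (next i) ≡ 0)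
next-cases {k} i with suc (toℕ i) <? suc k
... | yes i+1<k = inj₁ (FinP.toℕ-fromℕ< i+1<k)
... | no  i+1≮k = inj₂ (≤-antisym (s≤s⁻¹ (FinP.toℕ<n i)) (s≤s⁻¹ (≮⇒≥ i+1≮k)) , refl)

next-injective : ∀ {k} (i j : Fin k) → next i ≡ next j → i ≡ j
next-injective {suc k} i j eq with next-cases i | next-cases j
... | inj₁ p       | inj₁ q       = FinP.toℕ-injective (suc-injective (trans (sym p) (trans (cong toℕ eq) q)))
... | inj₁ p       | inj₂ (_ , q) = contradiction (trans (sym p) (trans (cong toℕ eq) q)) (λ ())
... | inj₂ (_ , p) | inj₁ q       = contradiction (trans (sym q) (trans (cong toℕ (sym eq)) p)) (λ ())
... | inj₂ (p , _) | inj₂ (q , _) = FinP.toℕ-injective (trans p (sym q))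

predF : ∀ {k} → Fin k → Fin k
predF {suc k} F.zero    = fromℕ k
predF {suc k} (F.suc i) = inject₁ i

next-predF : ∀ {k} (i : Fin k) → next (predF i) ≡ i
next-predF {suc k} F.zero with next-cases (fromℕ k)
... | inj₁ p = contradiction (subst (_< suc k) p (FinP.toℕ<n (next (fromℕ k))))
                             (λ lt → 1+n≰n (subst (λ x → suc x ≤ k) (FinP.toℕ-fromℕ k) (s≤s⁻¹ lt)))
... | inj₂ (_ , p) = FinP.toℕ-injective p
next-predF {suc k} (F.suc i) with next-cases (inject₁ i)
... | inj₁ p = FinP.toℕ-injective (trans p (cong suc (FinP.toℕ-inject₁ i)))
... | inj₂ (p , _) = contradiction (sym p) (FinP.toℕ-inject₁-≢ i)

bijection-size : ∀ {a b} (f : Fin a → Fin b) → Injective _≡_ _≡_ f → (∀ y → ∃ λ x → f x ≡ y) →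
                 a ≡ b
bijection-size f f-inj onto = ≤-antisym (FinP.injective⇒≤ f-inj) (FinP.injective⇒≤ section-inj)
  where
  section-inj : Injective _≡_ _≡_ (λ y → proj₁ (onto y))
  section-inj {y} {y′} eq = trans (sym (proj₂ (onto y))) (trans (cong f eq) (proj₂ (onto y′)))

index₀ : ∀ {k} → 2 ≤ k → Fin k
index₀ (s≤s _) = F.zero

next-≢ : ∀ {k} → 2 ≤ k → (i : Fin k) → next i ≢ i
next-≢ {suc k} k≥2 i eq with next-cases i
... | inj₁ p       = 1+n≢n (trans (sym p) (cong toℕ eq))
... | inj₂ (p , q) = <⇒≢ (s≤s⁻¹ k≥2) (sym (trans (sym p) (trans (sym (cong toℕ eq)) q)))

evenB : ℕ → Bool
evenB zero    = true
evenB (suc n) = not (evenB n)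

parity : ∀ n → (evenB n ≡ true → ∃ λ j → n ≡ 2 * j) × (evenB n ≡ false → Odd n)
parity zero = (λ _ → 0 , refl) , λ ()
parity (suc n) with evenB n | parity n
... | true  | (even , _) = (λ ()) , λ _ → let (j , n≡) = even refl in j , cong suc n≡
... | false | (_ , odd)  =
  (λ _ → let (j , n≡) = odd refl in suc j , cong suc (trans n≡ (sym (+-suc j (j + 0))))) , λ ()

predF-even : ∀ {k} (i : Fin k) → evenB (toℕ i) ≡ false → evenB (toℕ (predF i)) ≡ true
predF-even {suc k} (F.suc i) h rewrite FinP.toℕ-inject₁ i = not-false h

next-alternates : ∀ {k} → evenB k ≡ true → (j : Fin k) →
                  evenB (toℕ j) ≡ true → evenB (toℕ (next j)) ≡ false
next-alternates {suc k} k-even j j-even with next-cases j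
... | inj₁ p rewrite p | j-even = refl
... | inj₂ (p , q) rewrite q = contradiction k-even k-odd
  where
  k-odd : not (evenB k) ≢ true
  k-odd = subst (λ b → not b ≢ true) (sym (trans (cong evenB (sym p)) j-even)) (λ ())

incident-fst : (G : Graph) (e : Fin (m G)) (v : Fin (n G)) →
               v ≡ proj₁ (ends G e) → incident G e v ≡ true
incident-fst G e v v≡ with v ≟ proj₁ (ends G e)
... | yes _ = refl
... | no  ≢ = contradiction v≡ ≢

incident-snd : (G : Graph) (e : Fin (m G)) (v : Fin (n G)) →
               v ≡ proj₂ (ends G e) → incident G e v ≡ true
incident-snd G e v v≡ with v ≟ proj₁ (ends G e)
... | yes _ = refl
... | no  _ with v ≟ proj₂ (ends G e)
...   | yes _ = refl
...   | no  ≢ = contradiction v≡ ≢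

incident-ends : (G : Graph) (e : Fin (m G)) (v : Fin (n G)) → incident G e v ≡ true →
                v ≡ proj₁ (ends G e) ⊎ v ≡ proj₂ (ends G e)
incident-ends G e v h with v ≟ proj₁ (ends G e)
... | yes p = inj₁ p
... | no  _ with v ≟ proj₂ (ends G e)
...   | yes p = inj₂ p
incident-ends G e v () | no _ | no _

joins-incidentˡ : (G : Graph) {e : Fin (m G)} {a b : Fin (n G)} →
                  Joins G e a b → incident G e a ≡ true
joins-incidentˡ G {e} {a} (inj₁ p) = incident-fst G e a (cong proj₁ (sym p))
joins-incidentˡ G {e} {a} (inj₂ p) = incident-snd G e a (cong proj₂ (sym p))

joins-incidentʳ : (G : Graph) {e : Fin (m G)} {a b : Fin (n G)} →
                  Joins G e a b → incident G e b ≡ true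
joins-incidentʳ G {e} {b = b} (inj₁ p) = incident-snd G e b (cong proj₂ (sym p))
joins-incidentʳ G {e} {b = b} (inj₂ p) = incident-fst G e b (cong proj₁ (sym p))

joins-endpoint : (G : Graph) {e : Fin (m G)} {a b : Fin (n G)} → Joins G e a b →
                 ∀ x → incident G e x ≡ true → x ≡ a ⊎ x ≡ b
joins-endpoint G {e} J x h with J | incident-ends G e x h
... | inj₁ p | inj₁ q = inj₁ (trans q (cong proj₁ p))
... | inj₁ p | inj₂ q = inj₂ (trans q (cong proj₂ p))
... | inj₂ p | inj₁ q = inj₂ (trans q (cong proj₁ p))
... | inj₂ p | inj₂ q = inj₁ (trans q (cong proj₂ p))

module _ (G : Graph) (s : SpanningSub G) (v : Fin (n G)) where

  private
    keptAt : Fin (m G) → Bool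
    keptAt e = s e ∧ incident G e v

  degIn-pos : ∀ e → s e ≡ true → incident G e v ≡ true → 1 ≤ degIn G s v
  degIn-pos e se ie = count-pos keptAt e (∧-intro se ie)

  degIn-dropped : ∀ e → s e ≡ false → incident G e v ≡ true → degIn G s v ≤ Δ G ∸ 1
  degIn-dropped e se ie = ∸-monoˡ-≤ 1 (≤-trans fewer (maxF-≤ (deg G) v))
    where
    fewer : degIn G s v < deg G v
    fewer = count-strict keptAt (λ e → incident G e v) (λ _ h → proj₂ (∧-true h)) e
                         (subst (λ b → b ∧ incident G e v ≡ false) (sym se) refl) ie

  degIn-≤2 : ∀ a → (∀ e e′ → keptAt e ≡ true → keptAt e′ ≡ true → e ≢ a → e′ ≢ a → e ≡ e′) →
             degIn G s v ≤ 2
  degIn-≤2 a unique = count-≤2 keptAt a unique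

∷-cong : ∀ {A : Set} {k} (a : A) {f g : Fin k → A} → f ≗ g → (a ∷ f) ≗ (a ∷ g)
∷-cong a f≗g F.zero    = refl
∷-cong a f≗g (F.suc i) = f≗g i

∷-η : ∀ {A : Set} {k} (f : Fin (suc k) → A) → f ≗ (f F.zero ∷ λ i → f (F.suc i))
∷-η f F.zero    = refl
∷-η f (F.suc i) = refl

∃-fun? : ∀ {N} k (P : (Fin k → Fin N) → Set) → (∀ {f g} → f ≗ g → P f → P g) →
         (∀ f → Dec (P f)) → Dec (∃ P)
∃-fun? zero P resp P? with P? (λ ())
... | yes p = yes (_ , p)
... | no ¬p = no λ (f , pf) → ¬p (resp (λ ()) pf)
∃-fun? (suc k) P resp P?
  with FinP.any? (λ a → ∃-fun? k (λ g → P (a ∷ g)) (λ f≗g → resp (∷-cong a f≗g)) (λ g → P? (a ∷ g)))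
... | yes (a , g , p) = yes (a ∷ g , p)
... | no ¬p = no λ (f , pf) → ¬p (f F.zero , (λ i → f (F.suc i)) , resp (∷-η f) pf)

injective? : ∀ {k N} (f : Fin k → Fin N) → Dec (Injective _≡_ _≡_ f)
injective? f = map′ (λ inj {x} {y} → inj x y) (λ inj x y → inj {x} {y})
  (FinP.all? λ x → FinP.all? λ y → (f x ≟ f y) →-dec (x ≟ y))

joins? : (G : Graph) (e : Fin (m G)) (a b : Fin (n G)) → Dec (Joins G e a b)
joins? G e a b = ProdP.≡-dec _≟_ _≟_ (ends G e) (a , b) ⊎-dec
                 ProdP.≡-dec _≟_ _≟_ (ends G e) (b , a)

IsCycle : (G : Graph) {k : ℕ} → (Fin k → Fin (n G)) → (Fin k → Fin (m G)) → Set
IsCycle G vs es = Injective _≡_ _≡_ vs × Injective _≡_ _≡_ es ×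
                  (∀ i → Joins G (es i) (vs i) (vs (next i)))

IsCycle-resp : (G : Graph) {k : ℕ} {vs vs′ : Fin k → Fin (n G)} {es es′ : Fin k → Fin (m G)} →
               vs ≗ vs′ → es ≗ es′ → IsCycle G vs es → IsCycle G vs′ es′
IsCycle-resp G {vs′ = vs′} vs≗ es≗ (vs-inj , es-inj , joins) =
  (λ eq → vs-inj (trans (vs≗ _) (trans eq (sym (vs≗ _))))) ,
  (λ eq → es-inj (trans (es≗ _) (trans eq (sym (es≗ _))))) ,
  λ i → subst₂ (λ e v → Joins G e v (vs′ (next i))) (es≗ i) (vs≗ i)
               (subst (Joins G _ _) (vs≗ (next i)) (joins i))

IsCycle? : (G : Graph) {k : ℕ} (vs : Fin k → Fin (n G)) (es : Fin k → Fin (m G)) →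
           Dec (IsCycle G vs es)
IsCycle? G vs es = injective? vs ×-dec injective? es ×-dec
                   FinP.all? (λ i → joins? G (es i) (vs i) (vs (next i)))

cycle? : (G : Graph) (k : ℕ) → Dec (Cycle G k)
cycle? G k = map′ toCycle fromCycle ((2 ≤? k) ×-dec
  ∃-fun? k (λ vs → ∃ (IsCycle G vs)) (λ vs≗ (es , c) → es , IsCycle-resp G vs≗ (λ _ → refl) c)
    λ vs → ∃-fun? k (IsCycle G vs) (IsCycle-resp G (λ _ → refl)) (IsCycle? G vs))
  where
  toCycle : 2 ≤ k × ∃ (λ vs → ∃ (IsCycle G vs)) → Cycle G k
  toCycle (k≥2 , vs , es , vs-inj , es-inj , joins) =
    record { len≥2 = k≥2 ; vs = vs ; es = es ; vs-inj = vs-inj ; es-inj = es-inj ; joins = joins }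
  fromCycle : Cycle G k → 2 ≤ k × ∃ (λ vs → ∃ (IsCycle G vs))
  fromCycle c = len≥2 , vs , es , vs-inj , es-inj , joins
    where open Cycle c

module CycleForest (G : Graph) (conn : Connected G) {k : ℕ} (C : Cycle G k) where
  open Cycle C

  OffCycle : Fin (n G) → Set
  OffCycle v = ∀ i → vs i ≢ v

  -- a cycle edge has both ends on the cycle
  offCycle-avoids : ∀ {v} → OffCycle v → ∀ i → incident G (es i) v ≡ false
  offCycle-avoids {v} off i with incident G (es i) v in h
  ... | false = refl
  ... | true with joins-endpoint G (joins i) v h
  ...   | inj₁ p = contradiction (sym p) (off i)
  ...   | inj₂ p = contradiction (sym p) (off (next i))

  near : ℕ → Fin (n G) → Bool
  near zero    v = anyB (λ i → eqF (vs i) v)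
  near (suc t) v = near t v ∨ anyB (λ e → anyB (λ u → does (joins? G e v u) ∧ near t u))

  reach-near : ∀ {u} i → Reach G u (vs i) → ∃ λ t → near t u ≡ true
  reach-near i here = 0 , anyB-intro _ i (eqF-refl (vs i))
  reach-near i (step {w = x} e J walk) with reach-near i walk
  ... | t , near-x = suc t , ∨-right (anyB-intro _ e (anyB-intro _ x
                       (∧-intro (dec-true (joins? G e _ x) J) near-x)))

  near-step : ∀ t v → near (suc t) v ≡ true → near t v ≡ false →
              Σ (Fin (m G)) λ e → Σ (Fin (n G)) λ u → Joins G e v u × near t u ≡ true
  near-step t v h ¬near rewrite ¬near with anyB-elim _ h
  ... | e , he with anyB-elim _ he
  ...   | u , hu with ∧-true {does (joins? G e v u)} hu
  ...     | J , near-u = e , u , does-witness (joins? G e v u) J , near-u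

  i₀ : Fin k
  i₀ = index₀ len≥2

  -- the rank of v is its distance from the cycle
  rankData : ∀ v → Σ ℕ λ r → near r v ≡ true × (∀ t → near t v ≡ true → r ≤ t)
  rankData v with reach-near i₀ (proj₂ conn v (vs i₀))
  ... | t , near-v = least (λ t → near t v) t near-v

  rank : Fin (n G) → ℕ
  rank v = proj₁ (rankData v)

  rank-near : ∀ v → near (rank v) v ≡ true
  rank-near v = proj₁ (proj₂ (rankData v))

  rank-min : ∀ v t → near t v ≡ true → rank v ≤ t
  rank-min v = proj₂ (proj₂ (rankData v))

  onCycle-rank : ∀ {v} i → vs i ≡ v → rank v ≡ 0
  onCycle-rank {v} i refl = n≤0⇒n≡0 (rank-min v 0 (anyB-intro _ i (eqF-refl (vs i))))

  data Parent (v : Fin (n G)) : Set where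
    root   : (i : Fin k) → vs i ≡ v → Parent v
    edgeTo : (e : Fin (m G)) (u : Fin (n G)) → Joins G e v u → rank u < rank v →
             OffCycle v → Parent v

  parentAt : ∀ v r → rank v ≡ r → Parent v
  parentAt v zero rank≡0 with anyB-elim _ (subst (λ r → near r v ≡ true) rank≡0 (rank-near v))
  ... | i , h = root i (eqF-sound (vs i) v h)
  parentAt v (suc t) rank≡ with near t v in near-t
  ... | true  = contradiction (subst (_≤ t) rank≡ (rank-min v t near-t)) 1+n≰n
  ... | false with near-step t v (subst (λ r → near r v ≡ true) rank≡ (rank-near v)) near-t
  ...   | e , u , J , near-u =
    edgeTo e u J (subst (rank u <_) (sym rank≡) (s≤s (rank-min u t near-u)))
           (λ i vi → 1+n≢0 (trans (sym rank≡) (onCycle-rank i vi)))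

  parent : ∀ v → Parent v
  parent v = parentAt v (rank v) refl

  ownEdge : ∀ {v} → Parent v → Fin (m G)
  ownEdge (root i _)         = es i
  ownEdge (edgeTo e _ _ _ _) = e

  parentIs : ∀ {v} → Parent v → Fin (n G) → Bool
  parentIs (root _ _)          u = false
  parentIs (edgeTo _ u′ _ _ _) u = eqF u′ u

  own : Fin (n G) → Fin (m G)
  own v = ownEdge (parent v)

  childOf : Fin (n G) → Fin (n G) → Bool
  childOf w v = parentIs (parent w) v

  ownEdge-incident : ∀ {v} (p : Parent v) → incident G (ownEdge p) v ≡ true
  ownEdge-incident (root i refl)       = joins-incidentˡ G (joins i)
  ownEdge-incident (edgeTo _ _ J _ _) = joins-incidentˡ G J

  ownEdge-parent : ∀ {w} (p : Parent w) u → parentIs p u ≡ true →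
                   incident G (ownEdge p) u ≡ true × rank u < rank w
  ownEdge-parent (edgeTo e u′ J lt _) u h with eqF-sound u′ u h
  ... | refl = joins-incidentʳ G J , lt

  ownEdge-injective : ∀ {v w} (p : Parent v) (q : Parent w) → ownEdge p ≡ ownEdge q → v ≡ w
  ownEdge-injective (root i refl) (root j refl) eq = cong vs (es-inj eq)
  ownEdge-injective (root i _) (edgeTo e _ J _ off) refl =
    contradiction (joins-incidentˡ G J) (λ h → true≢false (trans (sym h) (offCycle-avoids off i)))
  ownEdge-injective (edgeTo e _ J _ off) (root i _) refl =
    contradiction (joins-incidentˡ G J) (λ h → true≢false (trans (sym h) (offCycle-avoids off i)))
  ownEdge-injective {v} {w} (edgeTo e u J u<v _) (edgeTo .e u′ J′ u′<w _) refl with v ≟ w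
  ... | yes v≡w = v≡w
  ... | no  v≢w with joins-endpoint G J w (joins-incidentˡ G J′)
                   | joins-endpoint G J′ v (joins-incidentˡ G J)
  ...   | inj₁ w≡v | _        = contradiction (sym w≡v) v≢w
  ...   | inj₂ _   | inj₁ v≡w = contradiction v≡w v≢w
  ...   | inj₂ refl | inj₂ refl = contradiction u′<w (<-asym u<v)

  ownEdge-far-end : ∀ {w} (p : Parent w) v → incident G (ownEdge p) v ≡ true → v ≢ w →
                    parentIs p v ≡ true ⊎ ∃ λ j → vs j ≡ w × vs (next j) ≡ v
  ownEdge-far-end (root j wj) v h v≢w with joins-endpoint G (joins j) v h
  ... | inj₁ v≡ = contradiction (trans v≡ wj) v≢w
  ... | inj₂ v≡ = inj₂ (j , wj , sym v≡)
  ownEdge-far-end (edgeTo e u J _ _) v h v≢w with joins-endpoint G J v h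
  ... | inj₁ v≡ = contradiction v≡ v≢w
  ... | inj₂ refl = inj₁ (eqF-refl u)

  -- Selection: a vertex is selected when none of its children is.  This is
  -- a recursion on the height maxF rank ∸ rank v, computed with h levels of
  -- fuel; any fuel exceeding the height gives the same answer.
  height : Fin (n G) → ℕ
  height v = maxF rank ∸ rank v

  child-height : ∀ w v → childOf w v ≡ true → height w < height v
  child-height w v h = ∸-monoʳ-< (proj₂ (ownEdge-parent (parent w) v h)) (maxF-≤ rank w)

  selAt : ℕ → Fin (n G) → Bool
  selAt zero    v = true
  selAt (suc h) v = not (anyB (λ w → childOf w v ∧ selAt h w))

  selAt-stable : ∀ h h′ v → height v < h → height v < h′ → selAt h v ≡ selAt h′ v
  selAt-stable (suc h) (suc h′) v v<h v<h′ = cong not (anyB-cong _ _ same)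
    where
    same : ∀ w → (childOf w v ∧ selAt h w) ≡ (childOf w v ∧ selAt h′ w)
    same w with childOf w v in c
    ... | false = refl
    ... | true  = selAt-stable h h′ w (<-≤-trans (child-height w v c) (s≤s⁻¹ v<h))
                                      (<-≤-trans (child-height w v c) (s≤s⁻¹ v<h′))

  selected : Fin (n G) → Bool
  selected v = selAt (suc (maxF rank)) v

  selected-unfold : ∀ v → selected v ≡ not (anyB (λ w → childOf w v ∧ selected w))
  selected-unfold v = cong not (anyB-cong _ _ same)
    where
    same : ∀ w → (childOf w v ∧ selAt (maxF rank) w) ≡ (childOf w v ∧ selected w)
    same w with childOf w v in c
    ... | false = refl
    ... | true  = selAt-stable (maxF rank) (suc (maxF rank)) w
                    (<-≤-trans (child-height w v c) (m∸n≤m (maxF rank) (rank v)))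
                    (s≤s (m∸n≤m (maxF rank) (rank w)))

  selected-childless : ∀ v w → selected v ≡ true → childOf w v ≡ true → selected w ≡ false
  selected-childless v w sv c with selected w in sw
  ... | false = refl
  ... | true  = contradiction (trans (sym sv) (selected-unfold v))
                  (λ eq → true≢false (trans eq (cong not (anyB-intro _ w (∧-intro c sw)))))

  unselected-child : ∀ v → selected v ≡ false → ∃ λ w → childOf w v ≡ true × selected w ≡ true
  unselected-child v sv with anyB-elim _ (not-false (trans (sym (selected-unfold v)) sv))
  ... | w , h = w , ∧-true h

  kept : SpanningSub G
  kept e = anyB (λ v → selected v ∧ eqF (own v) e)

  kept-own : ∀ v → selected v ≡ true → kept (own v) ≡ true
  kept-own v sv = anyB-intro _ v (∧-intro sv (eqF-refl (own v)))

  kept-owner : ∀ e → kept e ≡ true → ∃ λ w → selected w ≡ true × own w ≡ e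
  kept-owner e h with anyB-elim _ h
  ... | w , hw with ∧-true {selected w} hw
  ...   | sw , ow = w , sw , eqF-sound (own w) e ow

  dropped-own : ∀ v → selected v ≡ false → kept (own v) ≡ false
  dropped-own v sv with kept (own v) in h
  ... | false = refl
  ... | true with kept-owner (own v) h
  ...   | w , sw , eq with ownEdge-injective (parent w) (parent v) eq
  ...     | refl = contradiction (trans (sym sw) sv) true≢false

  kept-other : ∀ v e → selected v ≡ true → kept e ≡ true → incident G e v ≡ true → e ≢ own v →
               ∃ λ j → own (vs j) ≡ e × vs (next j) ≡ v
  kept-other v e sv ke ie e≢own with kept-owner e ke
  ... | w , sw , refl with v ≟ w
  ...   | yes refl = contradiction refl e≢own
  ...   | no v≢w with ownEdge-far-end (parent w) v ie v≢w
  ...     | inj₁ c = contradiction (trans (sym sw) (selected-childless v w sv c)) true≢false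
  ...     | inj₂ (j , refl , vj) = j , refl , vj

  kept-lower : ∀ v → 1 ≤ degIn G kept v
  kept-lower v with selected v in sv
  ... | true  = degIn-pos G kept v (own v) (kept-own v sv) (ownEdge-incident (parent v))
  ... | false with unselected-child v sv
  ...   | w , c , sw = degIn-pos G kept v (own w) (kept-own w sw)
                         (proj₁ (ownEdge-parent (parent w) v c))

  kept-upper : 3 ≤ Δ G → ∀ v → degIn G kept v ≤ Δ G ∸ 1
  kept-upper Δ≥3 v with selected v in sv
  ... | false = degIn-dropped G kept v (own v) (dropped-own v sv) (ownEdge-incident (parent v))
  ... | true  = ≤-trans (degIn-≤2 G kept v (own v) unique) (∸-monoˡ-≤ 1 Δ≥3)
    where
    unique : ∀ e e′ → kept e ∧ incident G e v ≡ true → kept e′ ∧ incident G e′ v ≡ true →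
             e ≢ own v → e′ ≢ own v → e ≡ e′
    unique e e′ h h′ e≢ e′≢ with ∧-true {kept e} h | ∧-true {kept e′} h′
    ... | ke , ie | ke′ , ie′ with kept-other v e sv ke ie e≢ | kept-other v e′ sv ke′ ie′ e′≢
    ...   | j , refl , vj | j′ , refl , vj′ =
      cong (λ i → own (vs i)) (next-injective j j′ (vs-inj (trans vj (sym vj′))))

  spanBelowΔ : 3 ≤ Δ G → HasSpan G (Δ G ∸ 1)
  spanBelowΔ Δ≥3 = kept , λ v → kept-lower v , kept-upper Δ≥3 v

module CycleCover (G : Graph) (conn : Connected G) {k : ℕ} (C : Cycle G k) where
  open Cycle C

  incident-here : ∀ i → incident G (es i) (vs i) ≡ true
  incident-here i = joins-incidentˡ G (joins i)

  incident-prev : ∀ i → incident G (es (predF i)) (vs i) ≡ true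
  incident-prev i = subst (λ j → incident G (es (predF i)) (vs j) ≡ true) (next-predF i)
                          (joins-incidentʳ G (joins (predF i)))

  here≢prev : ∀ i → es i ≢ es (predF i)
  here≢prev i eq = next-≢ len≥2 i (trans (cong next (es-inj eq)) (next-predF i))

  i₀ : Fin k
  i₀ = index₀ len≥2

  Δ≥2 : 2 ≤ Δ G
  Δ≥2 = ≤-trans (count-≥2 _ (es i₀) (es (predF i₀)) (here≢prev i₀) (incident-here i₀) (incident-prev i₀))
                (maxF-≤ (deg G) (vs i₀))

  OnCycle : Fin (n G) → Set
  OnCycle v = ∃ λ i → vs i ≡ v

  module _ (Δ≤2 : Δ G ≤ 2) where

    -- a third edge at vs i would give it degree 3
    cycle-edges-only : ∀ i e → incident G e (vs i) ≡ true → e ≡ es i ⊎ e ≡ es (predF i)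
    cycle-edges-only i e h with e ≟ es i | e ≟ es (predF i)
    ... | yes p | _     = inj₁ p
    ... | no _  | yes p = inj₂ p
    ... | no ≢here | no ≢prev =
      contradiction (≤-trans deg≥3 (≤-trans (maxF-≤ (deg G) (vs i)) Δ≤2)) 1+n≰n
      where
      deg≥3 : 3 ≤ deg G (vs i)
      deg≥3 = count-≥3 _ (es i) (es (predF i)) e (here≢prev i) (≢here ∘ sym) (≢prev ∘ sym)
                (incident-here i) (incident-prev i) h

    neighbour-onCycle : ∀ j e u → incident G e (vs j) ≡ true → incident G e u ≡ true → OnCycle u
    neighbour-onCycle j e u ej eu with cycle-edges-only j e ej
    ... | inj₁ refl with joins-endpoint G (joins j) u eu
    ...   | inj₁ u≡ = j , sym u≡
    ...   | inj₂ u≡ = next j , sym u≡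
    neighbour-onCycle j e u ej eu | inj₂ refl with joins-endpoint G (joins (predF j)) u eu
    ...   | inj₁ u≡ = predF j , sym u≡
    ...   | inj₂ u≡ = next (predF j) , sym u≡

    reach-onCycle : ∀ {u v} → Reach G u v → OnCycle v → OnCycle u
    reach-onCycle here on = on
    reach-onCycle (step {u = u} {w = x} e J walk) on with reach-onCycle walk on
    ... | j , refl = neighbour-onCycle j e u (joins-incidentʳ G J) (joins-incidentˡ G J)

    all-onCycle : ∀ v → OnCycle v
    all-onCycle v = reach-onCycle (proj₂ conn v (vs i₀)) (i₀ , refl)

    all-cycleEdges : ∀ e → ∃ λ i → es i ≡ e
    all-cycleEdges e with all-onCycle (proj₁ (ends G e))
    ... | j , vj with cycle-edges-only j e (incident-fst G e (vs j) vj)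
    ...   | inj₁ p = j , sym p
    ...   | inj₂ p = predF j , sym p

    length≡n : k ≡ n G
    length≡n = bijection-size vs vs-inj all-onCycle

    length≡m : k ≡ m G
    length≡m = bijection-size es es-inj all-cycleEdges

    -- the even-indexed cycle edges meet every vertex exactly once
    module _ (k-even : evenB k ≡ true) where

      alternate : SpanningSub G
      alternate e = anyB (λ i → eqF (es i) e ∧ evenB (toℕ i))

      alternate-even : ∀ i → evenB (toℕ i) ≡ true → alternate (es i) ≡ true
      alternate-even i h = anyB-intro _ i (∧-intro (eqF-refl (es i)) h)

      alternate-at : ∀ i e → (alternate e ∧ incident G e (vs i)) ≡ true →
                     ∃ λ j → es j ≡ e × evenB (toℕ j) ≡ true × (j ≡ i ⊎ next j ≡ i)
      alternate-at i e h with ∧-true {alternate e} h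
      ... | ae , ie with anyB-elim _ ae
      ...   | j , hj with ∧-true {eqF (es j) e} hj
      ...     | ej , j-even with eqF-sound (es j) e ej
      ...       | refl with joins-endpoint G (joins j) (vs i) ie
      ...         | inj₁ p = j , refl , j-even , inj₁ (vs-inj (sym p))
      ...         | inj₂ p = j , refl , j-even , inj₂ (vs-inj (sym p))

      alternate-degree : ∀ i → 1 ≤ degIn G alternate (vs i) × degIn G alternate (vs i) ≤ 1
      alternate-degree i = lower , count-≤1 _ unique
        where
        lower : 1 ≤ degIn G alternate (vs i)
        lower with evenB (toℕ i) in i-parity
        ... | true  = degIn-pos G alternate (vs i) (es i) (alternate-even i i-parity) (incident-here i)
        ... | false = degIn-pos G alternate (vs i) (es (predF i))
                        (alternate-even (predF i) (predF-even i i-parity)) (incident-prev i)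
        clash : ∀ j → evenB (toℕ j) ≡ true → evenB (toℕ (next j)) ≡ true → ⊥
        clash j a b = true≢false (trans (sym b) (next-alternates k-even j a))
        unique : ∀ e f → (alternate e ∧ incident G e (vs i)) ≡ true →
                 (alternate f ∧ incident G f (vs i)) ≡ true → e ≡ f
        unique e f he hf with alternate-at i e he | alternate-at i f hf
        ... | j , refl , _ , inj₁ p  | j′ , refl , _  , inj₁ p′ = cong es (trans p (sym p′))
        ... | j , refl , _ , inj₂ p  | j′ , refl , _  , inj₂ p′ =
          cong es (next-injective j j′ (trans p (sym p′)))
        ... | j , refl , a , inj₁ p  | j′ , refl , a′ , inj₂ p′ =
          ⊥-elim (clash j′ a′ (subst (λ x → evenB (toℕ x) ≡ true) (trans p (sym p′)) a))
        ... | j , refl , a , inj₂ p  | j′ , refl , a′ , inj₁ p′ =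
          ⊥-elim (clash j a (subst (λ x → evenB (toℕ x) ≡ true) (trans p′ (sym p)) a′))

      perfectMatching : HasSpan G 1
      perfectMatching = alternate , λ v → let (i , vi) = all-onCycle v in
        subst (λ x → 1 ≤ degIn G alternate x × degIn G alternate x ≤ 1) vi (alternate-degree i)

n≰n∸1 : ∀ {d} → 1 ≤ d → ¬ d ≤ d ∸ 1
n≰n∸1 {suc d} _ = 1+n≰n

cycle⇒Δ≤2 : (G : Graph) → Connected G → SpEq G (Δ G) → ∀ {k} → Cycle G k → Δ G ≤ 2
cycle⇒Δ≤2 G conn (_ , minimal) C with 3 ≤? Δ G
... | no  Δ≱3 = s≤s⁻¹ (≰⇒> Δ≱3)
... | yes Δ≥3 = contradiction (minimal _ (CycleForest.spanBelowΔ G conn C Δ≥3))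
                              (n≰n∸1 (≤-trans (s≤s z≤n) Δ≥3))

hamiltonian : (G : Graph) → Connected G → SpEq G (Δ G) → ∀ {k} → Cycle G k → k ≡ n G
hamiltonian G conn sp C = CycleCover.length≡n G conn C (cycle⇒Δ≤2 G conn sp C)

-- and a Hamiltonian cycle is odd, since an even one would give sp(G) = 1 < Δ(G)
hamiltonian-odd : (G : Graph) → Connected G → SpEq G (Δ G) → Cycle G (n G) → IsOddCycle G
hamiltonian-odd G conn sp@(_ , minimal) C = byParity (evenB (n G)) refl
  where
  open CycleCover G conn C
  Δ≤2 : Δ G ≤ 2
  Δ≤2 = cycle⇒Δ≤2 G conn sp C
  byParity : ∀ b → evenB (n G) ≡ b → IsOddCycle G
  byParity false n-odd  = proj₂ (parity (n G)) n-odd , sym (length≡m Δ≤2) , C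
  byParity true  n-even = contradiction (minimal 1 (perfectMatching Δ≤2 n-even)) (<⇒≱ Δ≥2)

mainTheorem5 : (G : Graph) → Connected G → NoIsolated G → SpEq G (Δ G) →
               IsOddCycle G ⊎ IsTree G
mainTheorem5 G conn _ sp with cycle? G (n G)
... | yes C = inj₁ (hamiltonian-odd G conn sp C)
... | no ¬C = inj₂ (conn , λ (k , C) → ¬C (subst (Cycle G) (hamiltonian G conn sp C) C))
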